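{- A pattern $p:[\ell]^2\to 2$ is irreducible if and only if for every partition $F\sqcup G=\{0,\dots,\ell-1\}$ such that $F\neq\emptyset$, $\operatorname{card} G\geq 2$ and $F<G$ (every element of $F$ is below every element of $G$), there are $x\in F$ and $y,z\in G$ with $p(x,y)\neq p(x,z)$.
   Context: A pattern is a function $p:[\ell]^2\to 2$, $\ell\ge1$, on unordered pairs from $\{0,\dots,\ell-1\}$; write $p(x,y)=p(\{x,y\})$. The join $p\uplus q$ of patterns $p,q$ is the pattern of length $|p|+|q|-1$ defined for $x<y<|p|+|q|-1$ by $(p\uplus q)(x,y)=p(x,y)$ if $y<|p|$; $=q(x-|p|+1,y-|p|+1)$ if $x\ge|p|-1$; $=p(x,|p|-1)$ if $x<|p|-1<y$. A pattern is reducible if it is of the form $p\uplus q$ with $|p|,|q|\ge2$, and irreducible otherwise. -}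

module Defs where

open import Data.Nat using (ℕ; zero; suc; _+_; _∸_; _<_; _≤_; _<?_)
open import Data.Fin using (Fin; toℕ; fromℕ<; cast)
open import Data.Bool using (Bool; false; if_then_else_)
open import Data.Product using (Σ; _×_; ∃)
open import Relation.Nullary using (¬_; yes; no)
open import Relation.Nullary.Decidable using (⌊_⌋)
open import Relation.Binary.PropositionalEquality using (_≡_; sym)

-- A pattern of length ℓ : a 2-colouring of unordered pairs {x,y} ⊆ [ℓ].
-- We represent it as a function Fin ℓ → Fin ℓ → Bool, where p(x,y) for x < y
-- is read as  p x y ; the values p x y with x ≥ y are irrelevant (ignored by
-- every notion below).
Pattern : ℕ → Set
Pattern ℓ = Fin ℓ → Fin ℓ → Bool

-- Pattern read on natural-number indices (false outside the range; only used
-- inside the range).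
at : ∀ {ℓ} → Pattern ℓ → ℕ → ℕ → Bool
at {ℓ} p x y with x <? ℓ | y <? ℓ
... | yes x<ℓ | yes y<ℓ = p (fromℕ< x<ℓ) (fromℕ< y<ℓ)
... | _ | _ = false

-- The join p ⊎ q, of length |p| + |q| - 1 (for x < y):
--   p(x,y)                         if y < |p|
--   q(x-|p|+1, y-|p|+1)            if x ≥ |p|-1
--   p(x, |p|-1)                    if x < |p|-1 < y
join : ∀ {a b} → Pattern a → Pattern b → Pattern (a + b ∸ 1)
join {a} {b} p q x y =
  if ⌊ toℕ y <? a ⌋ then at p (toℕ x) (toℕ y)
  else (if ⌊ toℕ x <? a ∸ 1 ⌋ then at p (toℕ x) (a ∸ 1)
        else at q (toℕ x ∸ (a ∸ 1)) (toℕ y ∸ (a ∸ 1)))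

_≈P_ : ∀ {ℓ} → Pattern ℓ → Pattern ℓ → Set
_≈P_ {ℓ} p r = ∀ (x y : Fin ℓ) → toℕ x < toℕ y → p x y ≡ r x y

Reducible : ∀ {ℓ} → Pattern ℓ → Set
Reducible {ℓ} p =
  Σ ℕ λ a → Σ ℕ λ b → Σ (Pattern a) λ r → Σ (Pattern b) λ s →
  2 ≤ a × 2 ≤ b × Σ (a + b ∸ 1 ≡ ℓ) λ e →
  p ≈P (λ x y → join r s (cast (sym e) x) (cast (sym e) y))

Irreducible : ∀ {ℓ} → Pattern ℓ → Set
Irreducible p = ¬ Reducible p

{-# OPTIONS --safe #-}
module Submission where

-- If p = r ⊎ s with |r| = k + 1, every x < k sees the whole final segment [k, ℓ) in the single
-- colour p(x, k); conversely, if p splits at k in this sense and 1 ≤ k ≤ ℓ - 2, then p is the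
-- join of its restrictions to [0, k] and [k, ℓ).  A partition F < G of [ℓ] with F nonempty and
-- |G| ≥ 2 is the cut at k = min G, and p fails to split there exactly when some x ∈ F
-- distinguishes two points of G; since this is a finite search, it is decidable which case holds.

open import Defs
open import Data.Bool using () renaming (_≟_ to _≟ᵇ_)
open import Data.Nat using (ℕ; zero; suc; _+_; _∸_; _<_; _≤_; _<?_; z≤n; z<s; s≤s; s<s)
open import Data.Nat.Properties
open import Data.Fin using (Fin; toℕ; fromℕ<; cast) renaming (zero to fzero; suc to fsuc)
open import Data.Fin.Properties using (toℕ<n; toℕ-fromℕ<; fromℕ<-toℕ; cast-is-id; any?)
open import Data.Fin.Subset
  using (Subset; _∈_; _⊆_; _∩_; _∪_; ∁; ⊥; ⊤; ⁅_⁆; ∣_∣; Nonempty; inside; outside)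
open import Data.Fin.Subset.Properties
  using ( _∈?_; ∉⊥; ∈⊤; ∣⁅x⁆∣≡1; x∈⁅y⁆⇒x≡y; x≢y⇒x∉⁅y⁆; p⊂q⇒∣p∣<∣q∣; x∈∁p⇒x∉p; x∉p⇒x∈∁p
        ; ∩-inverseʳ; p∪∁p≡⊤; x∈p∪q⁻)
open import Data.Product using (Σ; ∃; ∃₂; _×_; _,_)
open import Data.Sum using (_⊎_; inj₁; inj₂; [_,_]′)
open import Data.Vec using ([]; _∷_; here; there)
open import Function using (_∘_; id)
open import Function.Bundles using (_⇔_; mk⇔)
open import Relation.Nullary using (¬_; Dec; yes; no; contradiction; ¬?; _×-dec_)
open import Relation.Nullary.Decidable using (decidable-stable)
open import Relation.Binary.PropositionalEquality
  using (_≡_; _≢_; refl; sym; trans; cong; cong₂; subst; module ≡-Reasoning)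

open ≡-Reasoning

at-fromℕ< : ∀ {ℓ} (p : Pattern ℓ) {i j} (i<ℓ : i < ℓ) (j<ℓ : j < ℓ) →
            at p i j ≡ p (fromℕ< i<ℓ) (fromℕ< j<ℓ)
at-fromℕ< {ℓ} p {i} {j} i<ℓ j<ℓ with i <? ℓ | j <? ℓ
... | yes _   | yes _   = refl
... | no i≮ℓ  | _       = contradiction i<ℓ i≮ℓ
... | yes _   | no j≮ℓ  = contradiction j<ℓ j≮ℓ

at-toℕ : ∀ {ℓ} (p : Pattern ℓ) (x y : Fin ℓ) → at p (toℕ x) (toℕ y) ≡ p x y
at-toℕ p x y = trans (at-fromℕ< p (toℕ<n x) (toℕ<n y))
                     (cong₂ p (fromℕ<-toℕ x _) (fromℕ<-toℕ y _))

window : ∀ {ℓ} (o n : ℕ) → Pattern ℓ → Pattern n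
window o n p x y = at p (o + toℕ x) (o + toℕ y)

at-window : ∀ {ℓ} o n (p : Pattern ℓ) {i j} → i < n → j < n →
            at (window o n p) i j ≡ at p (o + i) (o + j)
at-window o n p i<n j<n =
  trans (at-fromℕ< (window o n p) i<n j<n)
        (cong₂ (λ i j → at p (o + i) (o + j)) (toℕ-fromℕ< i<n) (toℕ-fromℕ< j<n))

module _ {a b} (r : Pattern (suc a)) (s : Pattern b) (x y : Fin (suc a + b ∸ 1)) where

  join-below : toℕ y < suc a → join r s x y ≡ at r (toℕ x) (toℕ y)
  join-below y<1+a with toℕ y <? suc a
  ... | yes _     = refl
  ... | no y≮1+a = contradiction y<1+a y≮1+a

  join-across : toℕ x < a → a ≤ toℕ y → join r s x y ≡ at r (toℕ x) a
  join-across x<a a≤y with m≤n⇒m<n∨m≡n a≤y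
  ... | inj₂ a≡y = trans (join-below (s≤s (≤-reflexive (sym a≡y)))) (cong (at r (toℕ x)) (sym a≡y))
  ... | inj₁ a<y with toℕ y <? suc a | toℕ x <? a
  ...   | yes y<1+a | _      = contradiction a<y (<⇒≱ y<1+a)
  ...   | no _      | yes _  = refl
  ...   | no _      | no x≮a = contradiction x<a x≮a

  join-above : a ≤ toℕ x → suc a ≤ toℕ y → join r s x y ≡ at s (toℕ x ∸ a) (toℕ y ∸ a)
  join-above a≤x a<y with toℕ y <? suc a | toℕ x <? a
  ... | yes y<1+a | _       = contradiction a<y (<⇒≱ y<1+a)
  ... | no _      | yes x<a = contradiction a≤x (<⇒≱ x<a)
  ... | no _      | no _    = refl

join-cast-refl : ∀ {a b} (r : Pattern a) (s : Pattern b) (x y : Fin (a + b ∸ 1)) →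
                 join r s (cast refl x) (cast refl y) ≡ join r s x y
join-cast-refl r s x y = cong₂ (join r s) (cast-is-id refl x) (cast-is-id refl y)

SplitsAt : ∀ {ℓ} → Pattern ℓ → ℕ → Set
SplitsAt {ℓ} p k = ∀ (x y z : Fin ℓ) → toℕ x < k → k ≤ toℕ y → k ≤ toℕ z → p x y ≡ p x z

Splits : ∀ {ℓ} → Pattern ℓ → Set
Splits {ℓ} p = ∃ λ k → 0 < k × suc k < ℓ × SplitsAt p k

reducible⇒splits : ∀ {ℓ} (p : Pattern ℓ) → Reducible p → Splits p
reducible⇒splits p (suc a , b , r , s , s≤s 0<a , 2≤b , refl , p≈join) =
  a , 0<a , subst (_≤ a + b) (+-comm a 2) (+-monoʳ-≤ a 2≤b) ,
  λ x y z x<a a≤y a≤z → trans (across x y x<a a≤y) (sym (across x z x<a a≤z))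
  where
  across : ∀ x y → toℕ x < a → a ≤ toℕ y → p x y ≡ at r (toℕ x) a
  across x y x<a a≤y = begin
    p x y                                ≡⟨ p≈join x y (<-≤-trans x<a a≤y) ⟩
    join r s (cast refl x) (cast refl y) ≡⟨ join-cast-refl r s x y ⟩
    join r s x y                         ≡⟨ join-across r s x y x<a a≤y ⟩
    at r (toℕ x) a                       ∎

splitsAt⇒≈join : ∀ k b (p : Pattern (k + b)) → SplitsAt p k →
                 p ≈P join (window 0 (suc k) p) (window k b p)
splitsAt⇒≈join k b p splitsAt x y x<y = sym (by-position (k ≤? toℕ x) (k ≤? toℕ y))
  where
  r : Pattern (suc k)
  r = window 0 (suc k) p
  s : Pattern b
  s = window k b p

  below : toℕ x < k → toℕ y < k → join r s x y ≡ p x y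
  below x<k y<k = begin
    join r s x y          ≡⟨ join-below r s x y (m<n⇒m<1+n y<k) ⟩
    at r (toℕ x) (toℕ y)  ≡⟨ at-window 0 (suc k) p (m<n⇒m<1+n x<k) (m<n⇒m<1+n y<k) ⟩
    at p (toℕ x) (toℕ y)  ≡⟨ at-toℕ p x y ⟩
    p x y                 ∎

  across : toℕ x < k → k ≤ toℕ y → join r s x y ≡ p x y
  across x<k k≤y = begin
    join r s x y          ≡⟨ join-across r s x y x<k k≤y ⟩
    at r (toℕ x) k        ≡⟨ at-window 0 (suc k) p (m<n⇒m<1+n x<k) (n<1+n k) ⟩
    at p (toℕ x) k        ≡⟨ cong (at p (toℕ x)) toℕK≡k ⟨
    at p (toℕ x) (toℕ K)  ≡⟨ at-toℕ p x K ⟩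
    p x K                 ≡⟨ splitsAt x K y x<k (≤-reflexive (sym toℕK≡k)) k≤y ⟩
    p x y                 ∎
    where
    k<k+b : k < k + b
    k<k+b = ≤-<-trans k≤y (toℕ<n y)
    K : Fin (k + b)
    K = fromℕ< k<k+b
    toℕK≡k : toℕ K ≡ k
    toℕK≡k = toℕ-fromℕ< k<k+b

  above : k ≤ toℕ x → join r s x y ≡ p x y
  above k≤x = begin
    join r s x y                              ≡⟨ join-above r s x y k≤x (≤-<-trans k≤x x<y) ⟩
    at s (toℕ x ∸ k) (toℕ y ∸ k)              ≡⟨ at-window k b p (∸k<b k≤x) (∸k<b k≤y) ⟩
    at p (k + (toℕ x ∸ k)) (k + (toℕ y ∸ k))  ≡⟨ cong₂ (at p) (m+[n∸m]≡n k≤x) (m+[n∸m]≡n k≤y) ⟩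
    at p (toℕ x) (toℕ y)                      ≡⟨ at-toℕ p x y ⟩
    p x y                                     ∎
    where
    k≤y : k ≤ toℕ y
    k≤y = ≤-trans k≤x (<⇒≤ x<y)
    ∸k<b : ∀ {z : Fin (k + b)} → k ≤ toℕ z → toℕ z ∸ k < b
    ∸k<b {z} k≤z = +-cancelˡ-< k (toℕ z ∸ k) b (subst (_< k + b) (sym (m+[n∸m]≡n k≤z)) (toℕ<n z))

  by-position : Dec (k ≤ toℕ x) → Dec (k ≤ toℕ y) → join r s x y ≡ p x y
  by-position (yes k≤x) _         = above k≤x
  by-position (no k≰x)  (yes k≤y) = across (≰⇒> k≰x) k≤y
  by-position (no k≰x)  (no k≰y)  = below (≰⇒> k≰x) (≰⇒> k≰y)

splits⇒reducible : ∀ {ℓ} (p : Pattern ℓ) → Splits p → Reducible p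
splits⇒reducible p (k , 0<k , 1+k<ℓ , splitsAt) with m≤n⇒∃[o]m+o≡n (m+n≤o⇒n≤o 2 1+k<ℓ)
... | b , refl =
  suc k , b , window 0 (suc k) p , window k b p , s≤s 0<k , 2≤b , refl ,
  λ x y x<y → trans (splitsAt⇒≈join k b p splitsAt x y x<y)
                    (sym (join-cast-refl (window 0 (suc k) p) (window k b p) x y))
  where
  2≤b : 2 ≤ b
  2≤b = +-cancelˡ-≤ k 2 b (subst (_≤ k + b) (+-comm 2 k) 1+k<ℓ)

0<∣p∣⇒nonempty : ∀ {n} {p : Subset n} → 0 < ∣ p ∣ → Nonempty p
0<∣p∣⇒nonempty {p = inside ∷ p}  _      = fzero , here
0<∣p∣⇒nonempty {p = outside ∷ p} 0<∣p∣ with 0<∣p∣⇒nonempty 0<∣p∣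
... | x , x∈p = fsuc x , there x∈p

1<∣p∣⇒∃< : ∀ {n} {p : Subset n} → 1 < ∣ p ∣ → ∃₂ λ x y → x ∈ p × y ∈ p × toℕ x < toℕ y
1<∣p∣⇒∃< {p = inside ∷ p}  (s≤s 0<∣p∣) with 0<∣p∣⇒nonempty 0<∣p∣
... | y , y∈p = fzero , fsuc y , here , there y∈p , z<s
1<∣p∣⇒∃< {p = outside ∷ p} 1<∣p∣ with 1<∣p∣⇒∃< 1<∣p∣
... | x , y , x∈p , y∈p , x<y = fsuc x , fsuc y , there x∈p , there y∈p , s<s x<y

x≢y⇒1<∣p∣ : ∀ {n} {p : Subset n} {x y} → x ∈ p → y ∈ p → x ≢ y → 1 < ∣ p ∣
x≢y⇒1<∣p∣ {p = p} {x} {y} x∈p y∈p x≢y =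
  subst (_< ∣ p ∣) (∣⁅x⁆∣≡1 x) (p⊂q⇒∣p∣<∣q∣ (⁅x⁆⊆p , y , y∈p , x≢y⇒x∉⁅y⁆ (x≢y ∘ sym)))
  where
  ⁅x⁆⊆p : ⁅ x ⁆ ⊆ p
  ⁅x⁆⊆p z∈⁅x⁆ = subst (_∈ p) (sym (x∈⁅y⁆⇒x≡y x z∈⁅x⁆)) x∈p

nonempty⇒least : ∀ {n} {p : Subset n} → Nonempty p → ∃ λ m → m ∈ p × (∀ {x} → x ∈ p → toℕ m ≤ toℕ x)
nonempty⇒least {p = inside ∷ p}  _                  = fzero , here , λ _ → z≤n
nonempty⇒least {p = outside ∷ p} (fsuc x , there x∈p) with nonempty⇒least (x , x∈p)
... | m , m∈p , m≤ = fsuc m , there m∈p , λ { (there x∈p) → s≤s (m≤ x∈p) }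

below : ∀ {n} → ℕ → Subset n
below {zero}  _       = []
below {suc n} zero    = ⊥
below {suc n} (suc k) = inside ∷ below k

<⇒∈below : ∀ {n k} {x : Fin n} → toℕ x < k → x ∈ below k
<⇒∈below {suc n} {suc k} {fzero}  _          = here
<⇒∈below {suc n} {suc k} {fsuc x} (s<s x<k) = there (<⇒∈below x<k)

∈below⇒< : ∀ {n k} {x : Fin n} → x ∈ below k → toℕ x < k
∈below⇒< {suc n} {zero}  x∈⊥        = contradiction x∈⊥ ∉⊥
∈below⇒< {suc n} {suc k} here        = z<s
∈below⇒< {suc n} {suc k} (there x∈) = s<s (∈below⇒< x∈)

∈∁below⇒≥ : ∀ {n k} {x : Fin n} → x ∈ ∁ (below k) → k ≤ toℕ x
∈∁below⇒≥ x∈∁ = ≮⇒≥ (x∈∁p⇒x∉p x∈∁ ∘ <⇒∈below)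

≥⇒∈∁below : ∀ {n k} {x : Fin n} → k ≤ toℕ x → x ∈ ∁ (below k)
≥⇒∈∁below k≤x = x∉p⇒x∈∁p (≤⇒≯ k≤x ∘ ∈below⇒<)

below-nonempty : ∀ {n k} → 0 < k → k < n → Nonempty (below {n} k)
below-nonempty {suc n} {suc k} _ _ = fzero , here

1<∣∁below∣ : ∀ {n k} → suc k < n → 1 < ∣ ∁ (below {n} k) ∣
1<∣∁below∣ {n} {k} 1+k<n = x≢y⇒1<∣p∣ (≥⇒∈∁below k≤K) (≥⇒∈∁below (≤-trans (n≤1+n k) 1+k≤K⁺)) K≢K⁺
  where
  K K⁺ : Fin n
  K  = fromℕ< (<⇒≤ 1+k<n)
  K⁺ = fromℕ< 1+k<n
  k≤K : k ≤ toℕ K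
  k≤K = ≤-reflexive (sym (toℕ-fromℕ< (<⇒≤ 1+k<n)))
  1+k≤K⁺ : suc k ≤ toℕ K⁺
  1+k≤K⁺ = ≤-reflexive (sym (toℕ-fromℕ< 1+k<n))
  K≢K⁺ : K ≢ K⁺
  K≢K⁺ K≡K⁺ = 1+n≢n (begin
    suc k    ≡⟨ toℕ-fromℕ< 1+k<n ⟨
    toℕ K⁺   ≡⟨ cong toℕ K≡K⁺ ⟨
    toℕ K    ≡⟨ toℕ-fromℕ< (<⇒≤ 1+k<n) ⟩
    k        ∎)

ordered-cover⇒cut : ∀ {ℓ} {F G : Subset ℓ} → F ∪ G ≡ ⊤ →
                    ((x y : Fin ℓ) → x ∈ F → y ∈ G → toℕ x < toℕ y) → Nonempty F → 1 < ∣ G ∣ →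
                    ∃ λ k → 0 < k × suc k < ℓ ×
                            (∀ {x} → toℕ x < k → x ∈ F) × (∀ {y} → k ≤ toℕ y → y ∈ G)
ordered-cover⇒cut {ℓ} {F} {G} F∪G≡⊤ F<G (x₀ , x₀∈F) 1<∣G∣ with 1<∣p∣⇒∃< 1<∣G∣
... | y₁ , y₂ , y₁∈G , y₂∈G , y₁<y₂ with nonempty⇒least (y₁ , y₁∈G)
... | m , m∈G , m≤ =
  toℕ m , ≤-<-trans z≤n (F<G x₀ m x₀∈F m∈G) , ≤-<-trans (≤-<-trans (m≤ y₁∈G) y₁<y₂) (toℕ<n y₂) ,
  <m⇒∈F , m≤⇒∈G
  where
  ∈F⊎∈G : ∀ x → x ∈ F ⊎ x ∈ G
  ∈F⊎∈G x = x∈p∪q⁻ F G (subst (x ∈_) (sym F∪G≡⊤) ∈⊤)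
  <m⇒∈F : ∀ {x} → toℕ x < toℕ m → x ∈ F
  <m⇒∈F {x} x<m = [ id , (λ x∈G → contradiction (m≤ x∈G) (<⇒≱ x<m)) ]′ (∈F⊎∈G x)
  m≤⇒∈G : ∀ {y} → toℕ m ≤ toℕ y → y ∈ G
  m≤⇒∈G {y} m≤y = [ (λ y∈F → contradiction (F<G y m y∈F m∈G) (≤⇒≯ m≤y)) , id ]′ (∈F⊎∈G y)

Distinguishes : ∀ {ℓ} → Pattern ℓ → Subset ℓ → Subset ℓ → Set
Distinguishes {ℓ} p F G =
  Σ (Fin ℓ) λ x → Σ (Fin ℓ) λ y → Σ (Fin ℓ) λ z → x ∈ F × y ∈ G × z ∈ G × ¬ (p x y ≡ p x z)

distinguishes? : ∀ {ℓ} (p : Pattern ℓ) F G → Dec (Distinguishes p F G)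
distinguishes? p F G = any? λ x → any? λ y → any? λ z →
  x ∈? F ×-dec y ∈? G ×-dec z ∈? G ×-dec ¬? (p x y ≟ᵇ p x z)

irreducible⇒distinguishes : ∀ {ℓ} {p : Pattern ℓ} → Irreducible p → (F G : Subset ℓ) →
                            F ∪ G ≡ ⊤ → Nonempty F → 2 ≤ ∣ G ∣ →
                            ((x y : Fin ℓ) → x ∈ F → y ∈ G → toℕ x < toℕ y) → Distinguishes p F G
irreducible⇒distinguishes {p = p} irr F G F∪G≡⊤ F≢∅ 1<∣G∣ F<G with distinguishes? p F G
... | yes d = d
... | no ¬d with ordered-cover⇒cut F∪G≡⊤ F<G F≢∅ 1<∣G∣
...   | k , 0<k , 1+k<ℓ , <k⇒∈F , k≤⇒∈G =
  contradiction (splits⇒reducible p (k , 0<k , 1+k<ℓ , splitsAt)) irr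
  where
  splitsAt : SplitsAt p k
  splitsAt x y z x<k k≤y k≤z = decidable-stable (p x y ≟ᵇ p x z) λ pxy≢pxz →
    ¬d (x , y , z , <k⇒∈F x<k , k≤⇒∈G k≤y , k≤⇒∈G k≤z , pxy≢pxz)

distinguishes⇒irreducible : ∀ {ℓ} {p : Pattern ℓ} →
  ((F G : Subset ℓ) → F ∩ G ≡ ⊥ → F ∪ G ≡ ⊤ → Nonempty F → 2 ≤ ∣ G ∣ →
   ((x y : Fin ℓ) → x ∈ F → y ∈ G → toℕ x < toℕ y) → Distinguishes p F G) →
  Irreducible p
distinguishes⇒irreducible {ℓ} {p} distinguishes red with reducible⇒splits p red
... | k , 0<k , 1+k<ℓ , splitsAt
  with distinguishes (below k) (∁ (below k)) (∩-inverseʳ (below k)) (p∪∁p≡⊤ (below k))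
                     (below-nonempty 0<k (<⇒≤ 1+k<ℓ)) (1<∣∁below∣ 1+k<ℓ)
                     (λ x y x∈F y∈G → <-≤-trans (∈below⇒< x∈F) (∈∁below⇒≥ y∈G))
... | x , y , z , x∈F , y∈G , z∈G , pxy≢pxz =
  pxy≢pxz (splitsAt x y z (∈below⇒< x∈F) (∈∁below⇒≥ y∈G) (∈∁below⇒≥ z∈G))

lemma3p7 : (ℓ : ℕ) → 1 ≤ ℓ → (p : Pattern ℓ) →
    Irreducible p ⇔
      ((F G : Subset ℓ) → F ∩ G ≡ ⊥ → F ∪ G ≡ ⊤ → Nonempty F → 2 ≤ ∣ G ∣ →
        ((x y : Fin ℓ) → x ∈ F → y ∈ G → toℕ x < toℕ y) →
        Σ (Fin ℓ) λ x → Σ (Fin ℓ) λ y → Σ (Fin ℓ) λ z →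
          x ∈ F × y ∈ G × z ∈ G × ¬ (p x y ≡ p x z))
lemma3p7 _ _ _ = mk⇔ (λ irr F G _ → irreducible⇒distinguishes irr F G) distinguishes⇒irreducible
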